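{- Let $h,m,t$ be positive integers and $u$ an integer with $0 \le u < t$. Then $$N(h^{mt+u}) \ge \min \{N(t)-1,\ N(h^m),\ N(hm),\ N(hm+h;h),\ N(h^u) \}.$$
   Context: $N(v)$ denotes the maximum number of pairwise orthogonal latin squares of order $v$. A holey latin square of type $h^n$ is an $hn\times hn$ array with rows, columns and symbols indexed by $[hn]$, together with a partition of $[hn]$ into $n$ holes $H_1,\dots,H_n$ of size $h$, such that cell $(i,j)$ is empty iff $(i,j)\in\bigcup_k H_k\times H_k$ and otherwise contains one symbol, each row/column contains each symbol at most once, and symbols of $H_k$ do not appear in rows or columns indexed by $H_k$. Two such squares with the same holes are orthogonal if, superimposed, every ordered pair of symbols from different holes appears exactly once; $N(h^n)$ is the maximum number of such pairwise orthogonal squares with a common hole partition. For integers $v>h>0$, an incomplete latin square of order $v$ with a single hole $H\subseteq[v]$, $|H|=h$, is a $v\times v$ array with cell $(i,j)$ empty iff $(i,j)\in H\times H$ and otherwise containing a symbol of $[v]$, each row/column containing each symbol at most once, and symbols of $H$ not appearing in rows or columns indexed by $H$; two such squares with the same hole are orthogonal if superimposing them gives every ordered pair of symbols not both in $H$ exactly once. $N(v;h)$ is the maximum number of pairwise orthogonal such incomplete latin squares with a common hole of size $h$. -}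

module Defs where

open import Data.Nat using (ℕ; _*_)
open import Data.Fin using (Fin)
open import Data.Fin.Subset using (Subset; _∈_; ∣_∣)
open import Data.Maybe using (Maybe; just; nothing)
open import Data.Product using (Σ; _×_; ∃)
open import Data.Empty using (⊥)
open import Relation.Nullary using (¬_)
open import Relation.Binary.PropositionalEquality using (_≡_; _≢_)
open import Function.Bundles using (_↔_)

-- A v×v partial array with rows, columns, symbols indexed by Fin v,
-- with "hole relation" R : R i j holds iff i and j lie in a common hole.
--  * cell (i,j) is empty iff R i j;
--  * each symbol at most once in each row and each column;
--  * symbol s does not occur in row i (column j) when R s i (R s j).
-- Instances:
--  * ordinary latin square of order v :  R i j = ⊥
--  * holey latin square with hole map  :  R i j = (hole i ≡ hole j)
--  * incomplete latin square, hole H   :  R i j = (i ∈ H × j ∈ H)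
record PartialLS (v : ℕ) (R : Fin v → Fin v → Set) : Set where
  field
    cell     : Fin v → Fin v → Maybe (Fin v)
    emptyR   : ∀ i j → cell i j ≡ nothing → R i j
    Rempty   : ∀ i j → R i j → cell i j ≡ nothing
    rowInj   : ∀ i j j' s → cell i j ≡ just s → cell i j' ≡ just s → j ≡ j'
    colInj   : ∀ i i' j s → cell i j ≡ just s → cell i' j ≡ just s → i ≡ i'
    avoidRow : ∀ i j s → cell i j ≡ just s → ¬ R s i
    avoidCol : ∀ i j s → cell i j ≡ just s → ¬ R s j

open PartialLS public

Orthogonal : ∀ {v R} → PartialLS v R → PartialLS v R → Set
Orthogonal {v} {R} L M =
  ∀ a b → ¬ R a b →
    Σ (Fin v) (λ i → Σ (Fin v) (λ j →
      (cell L i j ≡ just a × cell M i j ≡ just b) ×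
      (∀ i' j' → cell L i' j' ≡ just a → cell M i' j' ≡ just b →
         (i' ≡ i × j' ≡ j))))

MutuallyOrthogonal : (v : ℕ) (R : Fin v → Fin v → Set) (k : ℕ) → Set
MutuallyOrthogonal v R k =
  Σ (Fin k → PartialLS v R) (λ Ls →
    ∀ p q → p ≢ q → Orthogonal (Ls p) (Ls q))

NoHole : ∀ {v} → Fin v → Fin v → Set
NoHole _ _ = ⊥

-- "N(v) ≥ k": there exist k MOLS of order v.
HasMOLS : ℕ → ℕ → Set
HasMOLS v k = MutuallyOrthogonal v NoHole k

-- "N(h^n) ≥ k": there is a partition of Fin (h*n) into n holes of size h
-- (given by hole : Fin (h*n) → Fin n with every fibre of size h) and
-- k pairwise orthogonal holey latin squares with that hole partition.
HasHMOLS : ℕ → ℕ → ℕ → Set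
HasHMOLS h n k =
  Σ (Fin (h * n) → Fin n) (λ hole →
    (∀ c → Fin h ↔ Σ (Fin (h * n)) (λ i → hole i ≡ c)) ×
    MutuallyOrthogonal (h * n) (λ i j → hole i ≡ hole j) k)

-- "N(v;h) ≥ k": there is a hole H ⊆ Fin v with |H| = h and k pairwise
-- orthogonal incomplete latin squares of order v with hole H.
HasIMOLS : ℕ → ℕ → ℕ → Set
HasIMOLS v h k =
  Σ (Subset v) (λ H →
    ∣ H ∣ ≡ h × MutuallyOrthogonal v (λ i j → i ∈ H × j ∈ H) k)

{-# OPTIONS --safe #-}
-- Normalise the k + 1 MOLS of order t by permuting columns and relabelling symbols: one square A
-- gets constant diagonal d, and the other k become idempotent squares L p, orthogonal to A and to
-- each other. Inflate each point x of order t to the hm points of the HMOLS of type h^m and add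
-- u groups of h infinite points, named by u symbols of A other than d. The diagonal block x gets
-- the HMOLS of type h^m; an off-diagonal block (x, y) gets the IMOLS of order hm + h when A x y names
-- an infinite group (its hole becoming that group), and the MOLS of order hm otherwise; the symbols
-- of block (x, y) lie in the group L p x y. The infinite points carry the HMOLS of type h^u.
--
-- Everything reduces to one uniqueness statement: two cells with the same pair of symbols coincide.
-- The pair of symbols determines the block (orthogonality of the L p and of A, idempotence keeping
-- the diagonal blocks apart), and within the block the ingredient determines the cell. Row and
-- column injectivity are the instances where one of the two squares is the square of row (or
-- column) indices, so these two squares are adjoined to the L p and to every ingredient.

module Submission where

open import Defs using (PartialLS; MutuallyOrthogonal; NoHole; HasMOLS; HasHMOLS; HasIMOLS)
open import Data.Empty using (⊥; ⊥-elim)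
open import Data.Fin using (Fin; toℕ; fromℕ<; inject≤; punchOut)
import Data.Fin.Properties as Fin
open import Data.Fin.Permutation using (cast-id)
open import Data.Fin.Subset using (Subset; _∈_; _∉_; ∣_∣; ∁; inside; outside)
open import Data.Fin.Subset.Properties using (∣∁p∣≡n∸∣p∣)
open import Data.Maybe using (Maybe; just; nothing; map)
open import Data.Maybe.Properties using (just-injective)
open import Data.Nat using (ℕ; suc; _+_; _*_; _∸_; _≤_; _<_)
import Data.Nat.Properties as ℕ
open import Data.Product using (Σ; ∃; ∃₂; _×_; _,_; proj₁; proj₂)
open import Data.Product.Algebra using (×-comm; ×-cong)
open import Data.Sum using (_⊎_; inj₁; inj₂; map₁; map₂)
open import Data.Sum.Algebra using (⊎-cong)
open import Data.Sum.Properties using (inj₁-injective)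
open import Data.Unit using (⊤; tt)
open import Data.Vec using (_∷_; here; there)
open import Function using (_∘_)
open import Function.Bundles using (_↔_; Inverse; Injection; mk↔ₛ′)
open import Function.Definitions using (Injective)
open import Function.Properties.Inverse using (↔-refl; ↔-sym; ↔-trans; Inverse⇒Injection)
open import Relation.Binary.PropositionalEquality
open import Relation.Nullary using (¬_; Dec; yes; no)
open import Relation.Nullary.Decidable using (dec-no)

open Inverse using (to; from; strictlyInverseˡ; strictlyInverseʳ)

private
  variable
    n : ℕ
    X Y : Set
    R : X → X → Set

-- Injective endomaps of finite types

↔-injective : (e : X ↔ Y) → Injective _≡_ _≡_ (to e)
↔-injective e = Injection.injective (Inverse⇒Injection e)

injective⇒surjective : {f : Fin n → Fin n} → Injective _≡_ _≡_ f → ∀ y → ∃ λ x → f x ≡ y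
injective⇒surjective {suc n} {f} f-inj y with Fin.any? (λ x → f x Fin.≟ y)
... | yes found = found
... | no ¬found = ⊥-elim (ℕ.1+n≰n (Fin.injective⇒≤ punched-injective))
  where
  y≢f : ∀ x → y ≢ f x
  y≢f x y≡fx = ¬found (x , sym y≡fx)
  punched-injective : Injective _≡_ _≡_ (λ x → punchOut (y≢f x))
  punched-injective eq = f-inj (Fin.punchOut-injective (y≢f _) (y≢f _) eq)

conjugate-injective : (e : X ↔ Fin n) {f : X → X} → Injective _≡_ _≡_ f →
                      Injective _≡_ _≡_ (to e ∘ f ∘ from e)
conjugate-injective e f-inj {i} {j} eq =
  trans (sym (strictlyInverseˡ e i)) (trans (cong (to e) (f-inj (↔-injective e eq))) (strictlyInverseˡ e j))

finite-injective⇒surjective : X ↔ Fin n → {f : X → X} → Injective _≡_ _≡_ f → ∀ y → ∃ λ x → f x ≡ y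
finite-injective⇒surjective e f-inj y with injective⇒surjective (conjugate-injective e f-inj) (to e y)
... | i , fi≡y = from e i , ↔-injective e fi≡y

injective⇒permutation : {f : Fin n → Fin n} → Injective _≡_ _≡_ f → Fin n ↔ Fin n
injective⇒permutation {f = f} f-inj =
  mk↔ₛ′ f (proj₁ ∘ solve) (proj₂ ∘ solve) (λ x → f-inj (proj₂ (solve (f x))))
  where
  solve : ∀ y → ∃ λ x → f x ≡ y
  solve = injective⇒surjective f-inj

-- Latin squares and orthogonality

Square : Set → Set
Square X = X → X → X

record Latin (f : Square X) : Set where
  field
    row-injective    : ∀ x → Injective _≡_ _≡_ (f x)
    column-injective : ∀ y → Injective _≡_ _≡_ (λ x → f x y)

OrthogonalSquares : Square X → Square X → Set
OrthogonalSquares f g = ∀ {x y x′ y′} → f x y ≡ f x′ y′ → g x y ≡ g x′ y′ → x ≡ x′ × y ≡ y′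

record MOLS (t k : ℕ) : Set where
  field
    square     : Fin k → Square (Fin t)
    latin      : ∀ p → Latin (square p)
    orthogonal : ∀ {p q} → p ≢ q → OrthogonalSquares (square p) (square q)

module _ {t : ℕ} {f : Square (Fin t)} (f-latin : Latin f) where
  open Latin f-latin

  row-solvable : ∀ x c → ∃ λ y → f x y ≡ c
  row-solvable x = injective⇒surjective (row-injective x)

  column-solvable : ∀ y c → ∃ λ x → f x y ≡ c
  column-solvable y = injective⇒surjective (column-injective y)

orthogonal⇒pair-injective : {f g : Square X} → OrthogonalSquares f g →
                            Injective _≡_ _≡_ (λ ((x , y) : X × X) → f x y , g x y)
orthogonal⇒pair-injective f⊥g eq with refl , refl ← f⊥g (cong proj₁ eq) (cong proj₂ eq) = refl

orthogonal⇒covers : ∀ {t} {f g : Square (Fin t)} → OrthogonalSquares f g →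
                    ∀ z w → ∃₂ λ x y → f x y ≡ z × g x y ≡ w
orthogonal⇒covers {t} f⊥g z w
  with (x , y) , eq ← finite-injective⇒surjective (↔-sym (Fin.*↔× {t} {t})) (orthogonal⇒pair-injective f⊥g) (z , w)
  = x , y , cong proj₁ eq , cong proj₂ eq

permuteColumns : (X → X) → Square X → Square X
permuteColumns π f x y = f x (π y)

relabel : (X → X) → Square X → Square X
relabel ρ f x y = ρ (f x y)

module _ {f : Square X} {π : X → X} (π-injective : Injective _≡_ _≡_ π) where

  permuteColumns-latin : Latin f → Latin (permuteColumns π f)
  permuteColumns-latin f-latin = record
    { row-injective    = λ x → π-injective ∘ row-injective x
    ; column-injective = λ y → column-injective (π y) }
    where open Latin f-latin

  permuteColumns-orthogonal : {g : Square X} → OrthogonalSquares f g →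
                              OrthogonalSquares (permuteColumns π f) (permuteColumns π g)
  permuteColumns-orthogonal f⊥g eq eq′ with x≡x′ , πy≡πy′ ← f⊥g eq eq′ = x≡x′ , π-injective πy≡πy′

  relabel-latin : Latin f → Latin (relabel π f)
  relabel-latin f-latin = record
    { row-injective    = λ x → row-injective x ∘ π-injective
    ; column-injective = λ y → column-injective y ∘ π-injective }
    where open Latin f-latin

relabel-orthogonal : {f g : Square X} {ρ ρ′ : X → X} → Injective _≡_ _≡_ ρ → Injective _≡_ _≡_ ρ′ →
                     OrthogonalSquares f g → OrthogonalSquares (relabel ρ f) (relabel ρ′ g)
relabel-orthogonal ρ-inj ρ′-inj f⊥g eq eq′ = f⊥g (ρ-inj eq) (ρ′-inj eq′)

data Axis : Set where
  byRow byColumn : Axis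

axisSquare : Axis → Square X
axisSquare byRow    x y = x
axisSquare byColumn x y = y

module _ {f : Square X} (f-latin : Latin f) where
  open Latin f-latin

  latin-axis-orthogonal : ∀ a → OrthogonalSquares f (axisSquare a)
  latin-axis-orthogonal byRow    eq refl = refl , row-injective _ eq
  latin-axis-orthogonal byColumn eq refl = column-injective _ eq , refl

  axis-latin-orthogonal : ∀ a → OrthogonalSquares (axisSquare a) f
  axis-latin-orthogonal a eq eq′ = latin-axis-orthogonal a eq′ eq

axes-orthogonal : ∀ {a b} → a ≢ b → OrthogonalSquares {X} (axisSquare a) (axisSquare b)
axes-orthogonal {a = byRow}    {byRow}    a≢b = ⊥-elim (a≢b refl)
axes-orthogonal {a = byRow}    {byColumn} _   = _,_
axes-orthogonal {a = byColumn} {byRow}    _   = λ eq eq′ → eq′ , eq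
axes-orthogonal {a = byColumn} {byColumn} a≢b = ⊥-elim (a≢b refl)

-- An idempotent normal form for MOLS

record IdempotentFrame (t k : ℕ) (d : Fin t) : Set where
  field
    A              : Square (Fin t)
    A-latin        : Latin A
    A-diagonal     : ∀ x → A x x ≡ d
    L              : Fin k → Square (Fin t)
    L-latin        : ∀ p → Latin (L p)
    L-idempotent   : ∀ p x → L p x x ≡ x
    L-orthogonal   : ∀ {p q} → p ≢ q → OrthogonalSquares (L p) (L q)
    A-L-orthogonal : ∀ p → OrthogonalSquares A (L p)

module _ {t k : ℕ} (B : MOLS t (suc k)) (d : Fin t) where
  open MOLS B

  -- The cells (x , σ x) all carry d in the first square, so each other square is injective on
  -- them; reading it there gives the relabelling τ p that makes it idempotent.
  private
    σ : Fin t → Fin t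
    σ x = proj₁ (row-solvable (latin Fin.zero) x d)

    σ-diagonal : ∀ x → square Fin.zero x (σ x) ≡ d
    σ-diagonal x = proj₂ (row-solvable (latin Fin.zero) x d)

    σ-injective : Injective _≡_ _≡_ σ
    σ-injective {x} {x′} σx≡σx′ = Latin.column-injective (latin Fin.zero) (σ x′)
      (trans (cong (square Fin.zero x) (sym σx≡σx′)) (trans (σ-diagonal x) (sym (σ-diagonal x′))))

    τ-injective : ∀ p → Injective _≡_ _≡_ (λ x → square (Fin.suc p) x (σ x))
    τ-injective p eq = proj₁ (orthogonal (λ ()) (trans (σ-diagonal _) (sym (σ-diagonal _))) eq)

    τ : Fin k → Fin t ↔ Fin t
    τ p = injective⇒permutation (τ-injective p)

  normalise : IdempotentFrame t k d
  normalise = record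
    { A              = permuteColumns σ (square Fin.zero)
    ; A-latin        = permuteColumns-latin σ-injective (latin Fin.zero)
    ; A-diagonal     = σ-diagonal
    ; L              = λ p → relabel (from (τ p)) (permuteColumns σ (square (Fin.suc p)))
    ; L-latin        = λ p → relabel-latin (τ⁻¹-injective p) (permuteColumns-latin σ-injective (latin (Fin.suc p)))
    ; L-idempotent   = λ p → strictlyInverseʳ (τ p)
    ; L-orthogonal   = λ p≢q → relabel-orthogonal (τ⁻¹-injective _) (τ⁻¹-injective _)
                         (permuteColumns-orthogonal σ-injective (orthogonal (p≢q ∘ Fin.suc-injective)))
    ; A-L-orthogonal = λ p → relabel-orthogonal (λ eq → eq) (τ⁻¹-injective p)
                         (permuteColumns-orthogonal σ-injective (orthogonal (λ ())))
    }
    where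
    τ⁻¹-injective : ∀ p → Injective _≡_ _≡_ (from (τ p))
    τ⁻¹-injective p = ↔-injective (↔-sym (τ p))

-- Partial latin squares with holes

just-preimage : {f : X → Y} (m : Maybe X) {b : Y} → map f m ≡ just b → ∃ λ a → m ≡ just a × f a ≡ b
just-preimage (just a) refl = a , refl , refl

nothing-preimage : {f : X → Y} (m : Maybe X) → map f m ≡ nothing → m ≡ nothing
nothing-preimage nothing _ = refl

Array : Set → Set
Array X = X → X → Maybe X

Covers : (X → X → Set) → Array X → Array X → Set
Covers {X} R F G = ∀ a b → ¬ R a b → ∃₂ λ (i j : X) → F i j ≡ just a × G i j ≡ just b

NoRepeatedPair : (X → X → Set) → Array X → Array X → Set
NoRepeatedPair R F G = ∀ {a b i j i′ j′} → ¬ R a b →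
  F i j ≡ just a → G i j ≡ just b → F i′ j′ ≡ just a → G i′ j′ ≡ just b → i ≡ i′ × j ≡ j′

-- The record PartialLS of Defs, over an arbitrary carrier.
record PartialLatin (X : Set) (R : X → X → Set) : Set where
  field
    cell     : Array X
    emptyR   : ∀ i j → cell i j ≡ nothing → R i j
    Rempty   : ∀ i j → R i j → cell i j ≡ nothing
    rowInj   : ∀ i j j′ s → cell i j ≡ just s → cell i j′ ≡ just s → j ≡ j′
    colInj   : ∀ i i′ j s → cell i j ≡ just s → cell i′ j ≡ just s → i ≡ i′
    avoidRow : ∀ i j s → cell i j ≡ just s → ¬ R s i
    avoidCol : ∀ i j s → cell i j ≡ just s → ¬ R s j

open PartialLatin

filled⇒not-hole : (L : PartialLatin X R) → ∀ {i j s} → cell L i j ≡ just s → ¬ R i j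
filled⇒not-hole L {i} {j} filled hole with () ← trans (sym filled) (Rempty L i j hole)

record MOPLS (X : Set) (R : X → X → Set) (k : ℕ) : Set where
  field
    square     : Fin k → PartialLatin X R
    covers     : ∀ {p q} → p ≢ q → Covers R (cell (square p)) (cell (square q))
    no-repeats : ∀ {p q} → p ≢ q → NoRepeatedPair R (cell (square p)) (cell (square q))

module Transport (e : X ↔ Y) {R : X → X → Set} {S : Y → Y → Set}
  (S⇒R : ∀ a c → S a c → R (from e a) (from e c))
  (R⇒S : ∀ a c → R (from e a) (from e c) → S a c) where

  private
    from-injective : Injective _≡_ _≡_ (from e)
    from-injective = ↔-injective (↔-sym e)

    transportArray : Array X → Array Y
    transportArray F i j = map (to e) (F (from e i) (from e j))

    transport-just : ∀ (F : Array X) {i j s} → transportArray F i j ≡ just s →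
                     F (from e i) (from e j) ≡ just (from e s)
    transport-just F {i} {j} eq with a , Fij , refl ← just-preimage (F (from e i) (from e j)) eq =
      trans Fij (cong just (sym (strictlyInverseʳ e a)))

    to-just : ∀ (F : Array X) {i j a} → F i j ≡ just a →
              transportArray F (to e i) (to e j) ≡ just (to e a)
    to-just F {i} {j} eq = cong (map (to e))
      (trans (cong₂ F (strictlyInverseʳ e i) (strictlyInverseʳ e j)) eq)

    transportSquare : PartialLatin X R → PartialLatin Y S
    transportSquare L = record
      { cell     = transportArray F
      ; emptyR   = λ i j eq → R⇒S i j (emptyR L _ _ (nothing-preimage _ eq))
      ; Rempty   = λ i j r → cong (map (to e)) (Rempty L _ _ (S⇒R i j r))
      ; rowInj   = λ i j j′ s e₁ e₂ → from-injective (rowInj L _ _ _ _ (transport-just F e₁) (transport-just F e₂))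
      ; colInj   = λ i i′ j s e₁ e₂ → from-injective (colInj L _ _ _ _ (transport-just F e₁) (transport-just F e₂))
      ; avoidRow = λ i j s eq → avoidRow L _ _ _ (transport-just F eq) ∘ S⇒R s i
      ; avoidCol = λ i j s eq → avoidCol L _ _ _ (transport-just F eq) ∘ S⇒R s j
      }
      where
      F : Array X
      F = cell L

    transport-covers : ∀ F G → Covers R F G → Covers S (transportArray F) (transportArray G)
    transport-covers F G cov a b ¬Sab with i , j , Fij , Gij ← cov (from e a) (from e b) (¬Sab ∘ R⇒S a b) =
      to e i , to e j ,
      trans (to-just F Fij) (cong just (strictlyInverseˡ e a)) ,
      trans (to-just G Gij) (cong just (strictlyInverseˡ e b))

    transport-no-repeats : ∀ F G → NoRepeatedPair R F G → NoRepeatedPair S (transportArray F) (transportArray G)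
    transport-no-repeats F G F⊥G ¬Sab e₁ e₂ e₃ e₄
      with i≡i′ , j≡j′ ← F⊥G (¬Sab ∘ R⇒S _ _) (transport-just F e₁) (transport-just G e₂)
                                            (transport-just F e₃) (transport-just G e₄)
      = from-injective i≡i′ , from-injective j≡j′

  transport : ∀ {k} → MOPLS X R k → MOPLS Y S k
  transport 𝓛 = record
    { square     = transportSquare ∘ square
    ; covers     = λ p≢q → transport-covers _ _ (covers p≢q)
    ; no-repeats = λ p≢q → transport-no-repeats _ _ (no-repeats p≢q)
    }
    where open MOPLS 𝓛

axisArray : Axis → Array X
axisArray a x y = just (axisSquare a x y)

module _ (L : PartialLatin X R) where

  partialLatin-axis-no-repeats : ∀ a → NoRepeatedPair R (cell L) (axisArray a)
  partialLatin-axis-no-repeats byRow    _ e₁ refl e₃ refl = refl , rowInj L _ _ _ _ e₁ e₃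
  partialLatin-axis-no-repeats byColumn _ e₁ refl e₃ refl = colInj L _ _ _ _ e₁ e₃ , refl

  axis-partialLatin-no-repeats : ∀ a → NoRepeatedPair R (axisArray a) (cell L)
  axis-partialLatin-no-repeats byRow    _ refl e₂ refl e₄ = refl , rowInj L _ _ _ _ e₂ e₄
  axis-partialLatin-no-repeats byColumn _ refl e₂ refl e₄ = colInj L _ _ _ _ e₂ e₄ , refl

axes-no-repeats : ∀ {a b} → a ≢ b → NoRepeatedPair {X} R (axisArray a) (axisArray b)
axes-no-repeats {a = byRow}    {byRow}    a≢b = ⊥-elim (a≢b refl)
axes-no-repeats {a = byRow}    {byColumn} _ _ refl refl refl refl = refl , refl
axes-no-repeats {a = byColumn} {byRow}    _ _ refl refl refl refl = refl , refl
axes-no-repeats {a = byColumn} {byColumn} a≢b = ⊥-elim (a≢b refl)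

Index : ℕ → Set
Index k = Fin k ⊎ Axis

module _ {k : ℕ} (𝓛 : MOPLS X R k) where
  open MOPLS 𝓛

  withAxes : Index k → Array X
  withAxes (inj₁ p) = cell (square p)
  withAxes (inj₂ a) = axisArray a

  withAxes-no-repeats : ∀ {p q} → p ≢ q → NoRepeatedPair R (withAxes p) (withAxes q)
  withAxes-no-repeats {inj₁ p} {inj₁ q} p≢q = no-repeats (p≢q ∘ cong inj₁)
  withAxes-no-repeats {inj₁ p} {inj₂ b} _   = partialLatin-axis-no-repeats (square p) b
  withAxes-no-repeats {inj₂ a} {inj₁ q} _   = axis-partialLatin-no-repeats (square q) a
  withAxes-no-repeats {inj₂ a} {inj₂ b} a≢b = axes-no-repeats {R = R} (a≢b ∘ cong inj₂)

-- Hole structures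

SameHole : ∀ {B C : Set} → B × C → B × C → Set
SameHole x y = proj₁ x ≡ proj₁ y

Fibre : ∀ {A B : Set} → (A → B) → B → Set
Fibre {A} f b = Σ A λ a → f a ≡ b

module _ {A B C : Set} (hole : A → B) (fibre : ∀ b → C ↔ Fibre hole b) where

  private
    coordinates : A → B × C
    coordinates a = hole a , from (fibre (hole a)) (a , refl)

    point : B × C → A
    point (b , c) = proj₁ (to (fibre b) c)

    coordinates-point : ∀ x → coordinates (point x) ≡ x
    coordinates-point (b , c) with to (fibre b) c | strictlyInverseʳ (fibre b) c
    ... | a , refl | from-to-c = cong (hole a ,_) from-to-c

    point-coordinates : ∀ a → point (coordinates a) ≡ a
    point-coordinates a = cong proj₁ (strictlyInverseˡ (fibre (hole a)) (a , refl))

  hole-coordinates : A ↔ (B × C)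
  hole-coordinates = mk↔ₛ′ coordinates point coordinates-point point-coordinates

  hole-point : ∀ x → hole (from hole-coordinates x) ≡ proj₁ x
  hole-point (b , c) = proj₂ (to (fibre b) c)

  toHoleCoordinates : ∀ {k} → MOPLS A (λ a a′ → hole a ≡ hole a′) k → MOPLS (B × C) SameHole k
  toHoleCoordinates = Transport.transport hole-coordinates
    (λ x y same → trans (hole-point x) (trans same (sym (hole-point y))))
    (λ x y eq → trans (sym (hole-point x)) (trans eq (hole-point y)))

fibre-≡ : ∀ {A B : Set} {f : A → B} {b} {x y : Fibre f b} → proj₁ x ≡ proj₁ y → x ≡ y
fibre-≡ {x = a , refl} {y = .a , refl} refl = refl

proj₁-fibre : ∀ {A B C : Set} (φ : (B × C) ↔ A) b → C ↔ Fibre (proj₁ ∘ from φ) b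
proj₁-fibre φ b = mk↔ₛ′ (λ c → to φ (b , c) , cong proj₁ (strictlyInverseʳ φ (b , c)))
                        (λ (a , _) → proj₂ (from φ a))
                        (λ where (a , refl) → fibre-≡ (strictlyInverseˡ φ a))
                        (λ c → cong proj₂ (strictlyInverseʳ φ (b , c)))

InHole : ∀ {A B : Set} → A ⊎ B → Set
InHole (inj₁ _) = ⊥
InHole (inj₂ _) = ⊤

BothInHole : ∀ {A B : Set} → A ⊎ B → A ⊎ B → Set
BothInHole x y = InHole x × InHole y

enumerate : ∀ {n} (H : Subset n) → Fin ∣ ∁ H ∣ ⊎ Fin ∣ H ∣ → Fin n
enumerate (inside ∷ H)  (inj₂ Fin.zero)    = Fin.zero
enumerate (inside ∷ H)  (inj₂ (Fin.suc j)) = Fin.suc (enumerate H (inj₂ j))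
enumerate (inside ∷ H)  (inj₁ i)           = Fin.suc (enumerate H (inj₁ i))
enumerate (outside ∷ H) (inj₁ Fin.zero)    = Fin.zero
enumerate (outside ∷ H) (inj₁ (Fin.suc i)) = Fin.suc (enumerate H (inj₁ i))
enumerate (outside ∷ H) (inj₂ j)           = Fin.suc (enumerate H (inj₂ j))

classify : ∀ {n} (H : Subset n) → Fin n → Fin ∣ ∁ H ∣ ⊎ Fin ∣ H ∣
classify (inside ∷ H)  Fin.zero    = inj₂ Fin.zero
classify (inside ∷ H)  (Fin.suc x) = map₂ Fin.suc (classify H x)
classify (outside ∷ H) Fin.zero    = inj₁ Fin.zero
classify (outside ∷ H) (Fin.suc x) = map₁ Fin.suc (classify H x)

enumerate-inside : ∀ {n} (H : Subset n) c → enumerate (inside ∷ H) (map₂ Fin.suc c) ≡ Fin.suc (enumerate H c)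
enumerate-inside H (inj₁ _) = refl
enumerate-inside H (inj₂ _) = refl

enumerate-outside : ∀ {n} (H : Subset n) c → enumerate (outside ∷ H) (map₁ Fin.suc c) ≡ Fin.suc (enumerate H c)
enumerate-outside H (inj₁ _) = refl
enumerate-outside H (inj₂ _) = refl

enumerate-classify : ∀ {n} (H : Subset n) x → enumerate H (classify H x) ≡ x
enumerate-classify (inside ∷ H)  Fin.zero    = refl
enumerate-classify (inside ∷ H)  (Fin.suc x) =
  trans (enumerate-inside H (classify H x)) (cong Fin.suc (enumerate-classify H x))
enumerate-classify (outside ∷ H) Fin.zero    = refl
enumerate-classify (outside ∷ H) (Fin.suc x) =
  trans (enumerate-outside H (classify H x)) (cong Fin.suc (enumerate-classify H x))

classify-enumerate : ∀ {n} (H : Subset n) c → classify H (enumerate H c) ≡ c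
classify-enumerate (inside ∷ H)  (inj₂ Fin.zero)    = refl
classify-enumerate (inside ∷ H)  (inj₂ (Fin.suc j)) = cong (map₂ Fin.suc) (classify-enumerate H (inj₂ j))
classify-enumerate (inside ∷ H)  (inj₁ i)           = cong (map₂ Fin.suc) (classify-enumerate H (inj₁ i))
classify-enumerate (outside ∷ H) (inj₁ Fin.zero)    = refl
classify-enumerate (outside ∷ H) (inj₁ (Fin.suc i)) = cong (map₁ Fin.suc) (classify-enumerate H (inj₁ i))
classify-enumerate (outside ∷ H) (inj₂ j)           = cong (map₁ Fin.suc) (classify-enumerate H (inj₂ j))

enumerate-∈ : ∀ {n} (H : Subset n) j → enumerate H (inj₂ j) ∈ H
enumerate-∈ (inside ∷ H)  Fin.zero    = here
enumerate-∈ (inside ∷ H)  (Fin.suc j) = there (enumerate-∈ H j)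
enumerate-∈ (outside ∷ H) j           = there (enumerate-∈ H j)

enumerate-∉ : ∀ {n} (H : Subset n) i → enumerate H (inj₁ i) ∉ H
enumerate-∉ (inside ∷ H)  i           (there i∈H) = enumerate-∉ H i i∈H
enumerate-∉ (outside ∷ H) (Fin.suc i) (there i∈H) = enumerate-∉ H i i∈H

subset-partition : ∀ {n} (H : Subset n) → (Fin ∣ ∁ H ∣ ⊎ Fin ∣ H ∣) ↔ Fin n
subset-partition H = mk↔ₛ′ (enumerate H) (classify H) (enumerate-classify H) (classify-enumerate H)

InflatedHole : ∀ {T Q W : Set} → (Q → Q → Set) → (W → W → Set) → (T × Q) ⊎ W → (T × Q) ⊎ W → Set
InflatedHole RQ RW (inj₁ (x , a)) (inj₁ (y , b)) = x ≡ y × RQ a b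
InflatedHole RQ RW (inj₁ _)       (inj₂ _)       = ⊥
InflatedHole RQ RW (inj₂ _)       (inj₁ _)       = ⊥
InflatedHole RQ RW (inj₂ w)       (inj₂ w′)      = RW w w′

regroup : ∀ {T B W H : Set} → ((T × (B × H)) ⊎ (W × H)) ↔ (((T × B) ⊎ W) × H)
regroup = mk↔ₛ′ (λ where (inj₁ (x , b , j)) → inj₁ (x , b) , j
                         (inj₂ (e , j))     → inj₂ e , j)
                (λ where (inj₁ (x , b) , j) → inj₁ (x , b , j)
                         (inj₂ e , j)       → inj₂ (e , j))
                (λ where (inj₁ _ , _) → refl
                         (inj₂ _ , _) → refl)
                (λ where (inj₁ _) → refl
                         (inj₂ _) → refl)

regroup-holes : ∀ {T B W H : Set} {k} →
  MOPLS ((T × (B × H)) ⊎ (W × H)) (InflatedHole SameHole SameHole) k → MOPLS (((T × B) ⊎ W) × H) SameHole k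
regroup-holes = Transport.transport regroup
  (λ where (inj₁ _ , _) (inj₁ _ , _) refl → refl , refl
           (inj₂ _ , _) (inj₂ _ , _) refl → refl)
  (λ where (inj₁ _ , _) (inj₁ _ , _) (refl , refl) → refl
           (inj₂ _ , _) (inj₂ _ , _) refl → refl)

-- The inflation construction

-- The symbols of A naming the u infinite groups; the diagonal symbol d names none.
record Labelling (t u : ℕ) (d : Fin t) : Set where
  field
    label         : Fin u → Fin t
    label≢d       : ∀ e → label e ≢ d
    unlabel       : Fin t → Maybe (Fin u)
    unlabel-label : ∀ e → unlabel (label e) ≡ just e
    unlabel-just  : ∀ {c e} → unlabel c ≡ just e → label e ≡ c

  label-injective : Injective _≡_ _≡_ label
  label-injective {e} {e′} eq =
    just-injective (trans (sym (unlabel-label e)) (trans (cong unlabel eq) (unlabel-label e′)))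

module Construction
  {t u k : ℕ} {d : Fin t} (labelling : Labelling t u d) (frame : IdempotentFrame t k d)
  {Q H : Set} {RQ : Q → Q → Set}
  (G : MOPLS Q RQ k) (M : MOPLS Q (λ _ _ → ⊥) k) (I : MOPLS (Q ⊎ H) BothInHole k)
  (U : MOPLS (Fin u × H) SameHole k)
  where

  open Labelling labelling
  open IdempotentFrame frame

  V : Set
  V = (Fin t × Q) ⊎ (Fin u × H)

  RV : V → V → Set
  RV = InflatedHole RQ SameHole

  L⁺ : Index k → Square (Fin t)
  L⁺ (inj₁ p) = L p
  L⁺ (inj₂ a) = axisSquare a

  L⁺-idempotent : ∀ p x → L⁺ p x x ≡ x
  L⁺-idempotent (inj₁ p)        = L-idempotent p
  L⁺-idempotent (inj₂ byRow)    _ = refl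
  L⁺-idempotent (inj₂ byColumn) _ = refl

  L⁺-orthogonal : ∀ {p q} → p ≢ q → OrthogonalSquares (L⁺ p) (L⁺ q)
  L⁺-orthogonal {inj₁ p} {inj₁ q} p≢q = L-orthogonal (p≢q ∘ cong inj₁)
  L⁺-orthogonal {inj₁ p} {inj₂ b} _   = latin-axis-orthogonal (L-latin p) b
  L⁺-orthogonal {inj₂ a} {inj₁ q} _   = axis-latin-orthogonal (L-latin q) a
  L⁺-orthogonal {inj₂ a} {inj₂ b} a≢b = axes-orthogonal (a≢b ∘ cong inj₂)

  A-L⁺-orthogonal : ∀ p → OrthogonalSquares A (L⁺ p)
  A-L⁺-orthogonal (inj₁ p) = A-L-orthogonal p
  A-L⁺-orthogonal (inj₂ a) = latin-axis-orthogonal A-latin a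

  L⁺-distinct : ∀ {p q x y} → p ≢ q → x ≢ y → L⁺ p x y ≢ L⁺ q x y
  L⁺-distinct {p} {q} {x} {y} p≢q x≢y eq =
    let (x≡z , y≡z) = L⁺-orthogonal p≢q (sym (L⁺-idempotent p (L⁺ p x y)))
                                       (trans (sym eq) (sym (L⁺-idempotent q (L⁺ p x y))))
    in x≢y (trans x≡z (sym y≡z))

  L-moves-row : ∀ p {x y} → x ≢ y → L p x y ≢ x
  L-moves-row p = L⁺-distinct {inj₁ p} {inj₂ byRow} (λ ())

  L-moves-column : ∀ p {x y} → x ≢ y → L p x y ≢ y
  L-moves-column p = L⁺-distinct {inj₁ p} {inj₂ byColumn} (λ ())

  labelled⇒off-diagonal : ∀ {x y e} → A x y ≡ label e → x ≢ y
  labelled⇒off-diagonal {x} {e = e} Axy≡e refl = label≢d e (trans (sym Axy≡e) (A-diagonal x))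

  labelled⇒not-unlabelled : ∀ {x y e} → A x y ≡ label e → unlabel (A x y) ≢ nothing
  labelled⇒not-unlabelled {e = e} A≡e unlabelled
    with () ← trans (sym (trans (cong unlabel A≡e) (unlabel-label e))) unlabelled

  embed : Fin t → Fin u → Q ⊎ H → V
  embed z e (inj₁ s) = inj₁ (z , s)
  embed z e (inj₂ j) = inj₂ (e , j)

  private
    inj₁-coordinates : ∀ {z z′ : Fin t} {s s′ : Q} →
                       _≡_ {A = V} (inj₁ (z , s)) (inj₁ (z′ , s′)) → z ≡ z′ × s ≡ s′
    inj₁-coordinates refl = refl , refl

    embed-inj₁ : ∀ {z w e s} σ → embed z e σ ≡ inj₁ (w , s) → z ≡ w × σ ≡ inj₁ s
    embed-inj₁ (inj₁ _) refl = refl , refl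

    embed-inj₂ : ∀ {z e e′ j} σ → embed z e σ ≡ inj₂ (e′ , j) → e ≡ e′ × σ ≡ inj₂ j
    embed-inj₂ (inj₂ _) refl = refl , refl

    embed-injective : ∀ {z e} σ σ′ → embed z e σ ≡ embed z e σ′ → σ ≡ σ′
    embed-injective (inj₁ _) (inj₁ _) refl = refl
    embed-injective (inj₂ _) (inj₂ _) refl = refl

    embed-not-both-in-hole : ∀ {z z′ e} σ τ → ¬ RV (embed z e σ) (embed z′ e τ) → ¬ BothInHole σ τ
    embed-not-both-in-hole (inj₂ _) (inj₂ _) ¬R _ = ¬R refl

    embed-separated : ∀ {z x e} σ r → z ≢ x → ¬ BothInHole σ r → ¬ RV (embed z e σ) (embed x e r)
    embed-separated (inj₁ _) (inj₁ _) z≢x _     (z≡x , _) = z≢x z≡x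
    embed-separated (inj₂ _) (inj₂ _) _   ¬both _         = ¬both (tt , tt)

  -- labelled x y e r c is the cell (r , c) of the IMOLS in block (x , y); its hole coordinates
  -- stand for the points of infinite group e.
  data Site : Set where
    diagonal : Fin t → Q → Q → Site
    labelled : Fin t → Fin t → Fin u → Q ⊎ H → Q ⊎ H → Site
    plain    : Fin t → Fin t → Q → Q → Site
    infinite : Fin u × H → Fin u × H → Site

  Valid : Site → Set
  Valid (diagonal _ _ _)       = ⊤
  Valid (labelled x y e r c)   = A x y ≡ label e × ¬ BothInHole r c
  Valid (plain x y _ _)        = x ≢ y × unlabel (A x y) ≡ nothing
  Valid (infinite _ _)         = ⊤

  siteRow : Site → V
  siteRow (diagonal x a _)     = inj₁ (x , a)
  siteRow (labelled x _ e r _) = embed x e r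
  siteRow (plain x _ a _)      = inj₁ (x , a)
  siteRow (infinite w _)       = inj₂ w

  siteColumn : Site → V
  siteColumn (diagonal x _ b)     = inj₁ (x , b)
  siteColumn (labelled _ y e _ c) = embed y e c
  siteColumn (plain _ y _ b)      = inj₁ (y , b)
  siteColumn (infinite _ w′)      = inj₂ w′

  G⁺ M⁺ : Index k → Array Q
  G⁺ = withAxes G
  M⁺ = withAxes M

  I⁺ : Index k → Array (Q ⊎ H)
  I⁺ = withAxes I

  U⁺ : Index k → Array (Fin u × H)
  U⁺ = withAxes U

  entry : Index k → Site → Maybe V
  entry p (diagonal x a b)     = map (λ s → inj₁ (x , s)) (G⁺ p a b)
  entry p (labelled x y e r c) = map (embed (L⁺ p x y) e) (I⁺ p r c)
  entry p (plain x y a b)      = map (λ s → inj₁ (L⁺ p x y , s)) (M⁺ p a b)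
  entry p (infinite w w′)      = map inj₂ (U⁺ p w w′)

  entry-axis : ∀ a s → entry (inj₂ a) s ≡ just (axisSquare a (siteRow s) (siteColumn s))
  entry-axis byRow    (diagonal _ _ _)     = refl
  entry-axis byRow    (labelled _ _ _ _ _) = refl
  entry-axis byRow    (plain _ _ _ _)      = refl
  entry-axis byRow    (infinite _ _)       = refl
  entry-axis byColumn (diagonal _ _ _)     = refl
  entry-axis byColumn (labelled _ _ _ _ _) = refl
  entry-axis byColumn (plain _ _ _ _)      = refl
  entry-axis byColumn (infinite _ _)       = refl

  solveRow : Fin t → Fin t → Fin t
  solveRow x c = proj₁ (row-solvable A-latin x c)

  solveColumn : Fin t → Fin t → Fin t
  solveColumn y c = proj₁ (column-solvable A-latin y c)

  block : (x : Fin t) → Q → (y : Fin t) → Q → Dec (x ≡ y) → Maybe (Fin u) → Site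
  block x a y b (yes _) _        = diagonal x a b
  block x a y b (no _)  (just e) = labelled x y e (inj₁ a) (inj₁ b)
  block x a y b (no _)  nothing  = plain x y a b

  site : V → V → Site
  site (inj₁ (x , a)) (inj₁ (y , b)) = block x a y b (x Fin.≟ y) (unlabel (A x y))
  site (inj₁ (x , a)) (inj₂ (e , j)) = labelled x (solveRow x (label e)) e (inj₁ a) (inj₂ j)
  site (inj₂ (e , j)) (inj₁ (y , b)) = labelled (solveColumn y (label e)) y e (inj₂ j) (inj₁ b)
  site (inj₂ w)       (inj₂ w′)      = infinite w w′

  block-valid : ∀ x a y b (x≟y : Dec (x ≡ y)) {m} → unlabel (A x y) ≡ m → Valid (block x a y b x≟y m)
  block-valid x a y b (yes _)  _          = tt
  block-valid x a y b (no _)   {just e} eq = sym (unlabel-just eq) , λ ()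
  block-valid x a y b (no x≢y) {nothing} eq = x≢y , eq

  site-valid : ∀ r c → Valid (site r c)
  site-valid (inj₁ (x , a)) (inj₁ (y , b)) = block-valid x a y b (x Fin.≟ y) refl
  site-valid (inj₁ (x , a)) (inj₂ (e , j)) = proj₂ (row-solvable A-latin x (label e)) , λ ()
  site-valid (inj₂ (e , j)) (inj₁ (y , b)) = proj₂ (column-solvable A-latin y (label e)) , λ ()
  site-valid (inj₂ _)       (inj₂ _)       = tt

  site-row : ∀ r c → siteRow (site r c) ≡ r
  site-row (inj₁ (x , a)) (inj₁ (y , b)) with x Fin.≟ y | unlabel (A x y)
  ... | yes _ | _       = refl
  ... | no _  | just _  = refl
  ... | no _  | nothing = refl
  site-row (inj₁ _) (inj₂ _) = refl
  site-row (inj₂ _) (inj₁ _) = refl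
  site-row (inj₂ _) (inj₂ _) = refl

  site-column : ∀ r c → siteColumn (site r c) ≡ c
  site-column (inj₁ (x , a)) (inj₁ (y , b)) with x Fin.≟ y | unlabel (A x y)
  ... | yes refl | _       = refl
  ... | no _     | just _  = refl
  ... | no _     | nothing = refl
  site-column (inj₁ _) (inj₂ _) = refl
  site-column (inj₂ _) (inj₁ _) = refl
  site-column (inj₂ _) (inj₂ _) = refl

  site-of-valid : ∀ s → Valid s → site (siteRow s) (siteColumn s) ≡ s
  site-of-valid (diagonal x a b) _ with x Fin.≟ x
  ... | yes _  = refl
  ... | no x≢x = ⊥-elim (x≢x refl)
  site-of-valid (labelled x y e (inj₁ a) (inj₁ b)) (Axy≡e , _)
    rewrite dec-no (x Fin.≟ y) (labelled⇒off-diagonal Axy≡e)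
          | trans (cong unlabel Axy≡e) (unlabel-label e) = refl
  site-of-valid (labelled x y e (inj₁ a) (inj₂ j)) (Axy≡e , _) =
    cong (λ y′ → labelled x y′ e (inj₁ a) (inj₂ j))
         (Latin.row-injective A-latin x (trans (proj₂ (row-solvable A-latin x (label e))) (sym Axy≡e)))
  site-of-valid (labelled x y e (inj₂ j) (inj₁ b)) (Axy≡e , _) =
    cong (λ x′ → labelled x′ y e (inj₂ j) (inj₁ b))
         (Latin.column-injective A-latin y (trans (proj₂ (column-solvable A-latin y (label e))) (sym Axy≡e)))
  site-of-valid (labelled x y e (inj₂ _) (inj₂ _)) (_ , ¬both) = ⊥-elim (¬both (tt , tt))
  site-of-valid (plain x y a b) (x≢y , unlabelled) rewrite dec-no (x Fin.≟ y) x≢y | unlabelled = refl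
  site-of-valid (infinite _ _) _ = refl

  Determines : Index k → Index k → Site → Site → Set
  Determines p q s s′ = ∀ {α β} → ¬ RV α β →
    entry p s ≡ just α → entry q s ≡ just β → entry p s′ ≡ just α → entry q s′ ≡ just β → s ≡ s′

  determines-sym : ∀ {p q} s s′ → Determines p q s s′ → Determines p q s′ s
  determines-sym _ _ D ¬R e₁ e₂ e₃ e₄ = sym (D ¬R e₃ e₄ e₁ e₂)

  diagonal-diagonal : ∀ {p q} → p ≢ q → ∀ {x a b x′ a′ b′} →
                      Determines p q (diagonal x a b) (diagonal x′ a′ b′)
  diagonal-diagonal {p} {q} p≢q {x} {a} {b} {x′} {a′} {b′} ¬R e₁ e₂ e₃ e₄
    with σ  , Gp  , refl ← just-preimage (G⁺ p a b) e₁
       | τ  , Gq  , refl ← just-preimage (G⁺ q a b) e₂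
       | σ′ , Gp′ , refl ← just-preimage (G⁺ p a′ b′) e₃
       | τ′ , Gq′ , refl ← just-preimage (G⁺ q a′ b′) e₄
    with refl , refl ← withAxes-no-repeats G p≢q (λ r → ¬R (refl , r)) Gp Gq Gp′ Gq′
    = refl

  diagonal-labelled : ∀ {p q} → p ≢ q → ∀ {x a b x′ y′ e r c} → Valid (labelled x′ y′ e r c) →
                      Determines p q (diagonal x a b) (labelled x′ y′ e r c)
  diagonal-labelled {p} {q} p≢q {x} {a} {b} {x′} {y′} {e} {r} {c} (A≡e , _) ¬R e₁ e₂ e₃ e₄
    with σ  , _ , refl ← just-preimage (G⁺ p a b) e₁
       | τ  , _ , refl ← just-preimage (G⁺ q a b) e₂
       | σ′ , _ , eq₃  ← just-preimage (I⁺ p r c) e₃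
       | τ′ , _ , eq₄  ← just-preimage (I⁺ q r c) e₄
    = ⊥-elim (L⁺-distinct p≢q (labelled⇒off-diagonal A≡e)
               (trans (proj₁ (embed-inj₁ σ′ eq₃)) (sym (proj₁ (embed-inj₁ τ′ eq₄)))))

  diagonal-plain : ∀ {p q} → p ≢ q → ∀ {x a b x′ y′ a′ b′} → Valid (plain x′ y′ a′ b′) →
                   Determines p q (diagonal x a b) (plain x′ y′ a′ b′)
  diagonal-plain {p} {q} p≢q {x} {a} {b} {x′} {y′} {a′} {b′} (x′≢y′ , _) ¬R e₁ e₂ e₃ e₄
    with σ  , _ , refl ← just-preimage (G⁺ p a b) e₁
       | τ  , _ , refl ← just-preimage (G⁺ q a b) e₂
       | σ′ , _ , eq₃  ← just-preimage (M⁺ p a′ b′) e₃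
       | τ′ , _ , eq₄  ← just-preimage (M⁺ q a′ b′) e₄
    = ⊥-elim (L⁺-distinct p≢q x′≢y′
               (trans (proj₁ (inj₁-coordinates eq₃)) (sym (proj₁ (inj₁-coordinates eq₄)))))

  diagonal-infinite : ∀ {p q x a b w w′} → Determines p q (diagonal x a b) (infinite w w′)
  diagonal-infinite {p} {q} {x} {a} {b} {w} {w′} ¬R e₁ e₂ e₃ e₄
    with σ , _ , refl ← just-preimage (G⁺ p a b) e₁
       | _ , _ , ()   ← just-preimage (U⁺ p w w′) e₃

  plain-plain : ∀ {p q} → p ≢ q → ∀ {x y a b x′ y′ a′ b′} →
                Determines p q (plain x y a b) (plain x′ y′ a′ b′)
  plain-plain {p} {q} p≢q {x} {y} {a} {b} {x′} {y′} {a′} {b′} ¬R e₁ e₂ e₃ e₄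
    with σ  , Mp  , refl ← just-preimage (M⁺ p a b) e₁
       | τ  , Mq  , refl ← just-preimage (M⁺ q a b) e₂
       | σ′ , Mp′ , eq₃  ← just-preimage (M⁺ p a′ b′) e₃
       | τ′ , Mq′ , eq₄  ← just-preimage (M⁺ q a′ b′) e₄
    with zp , refl ← inj₁-coordinates eq₃
       | zq , refl ← inj₁-coordinates eq₄
    with refl , refl ← L⁺-orthogonal p≢q zp zq
       | refl , refl ← withAxes-no-repeats M p≢q (λ ()) Mp Mq Mp′ Mq′
    = refl

  plain-infinite : ∀ {p q x y a b w w′} → Determines p q (plain x y a b) (infinite w w′)
  plain-infinite {p} {q} {x} {y} {a} {b} {w} {w′} ¬R e₁ e₂ e₃ e₄
    with σ , _ , refl ← just-preimage (M⁺ p a b) e₁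
       | _ , _ , ()   ← just-preimage (U⁺ p w w′) e₃

  infinite-infinite : ∀ {p q} → p ≢ q → ∀ {w₁ w₂ w₃ w₄} →
                      Determines p q (infinite w₁ w₂) (infinite w₃ w₄)
  infinite-infinite {p} {q} p≢q {w₁} {w₂} {w₃} {w₄} ¬R e₁ e₂ e₃ e₄
    with σ  , Up  , refl ← just-preimage (U⁺ p w₁ w₂) e₁
       | τ  , Uq  , refl ← just-preimage (U⁺ q w₁ w₂) e₂
       | σ′ , Up′ , refl ← just-preimage (U⁺ p w₃ w₄) e₃
       | τ′ , Uq′ , refl ← just-preimage (U⁺ q w₃ w₄) e₄
    with refl , refl ← withAxes-no-repeats U p≢q ¬R Up Uq Up′ Uq′
    = refl

  labelled-block-determined :
    ∀ {p q} → p ≢ q → ∀ {x y e x′ y′ e′} σ τ σ′ τ′ → A x y ≡ label e → A x′ y′ ≡ label e′ →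
    ¬ RV (embed (L⁺ p x y) e σ) (embed (L⁺ q x y) e τ) →
    embed (L⁺ p x′ y′) e′ σ′ ≡ embed (L⁺ p x y) e σ → embed (L⁺ q x′ y′) e′ τ′ ≡ embed (L⁺ q x y) e τ →
    x′ ≡ x × y′ ≡ y × e′ ≡ e
  labelled-block-determined p≢q (inj₁ _) (inj₁ _) σ′ τ′ A≡e A≡e′ _ eq₃ eq₄
    with refl , refl ← L⁺-orthogonal p≢q (proj₁ (embed-inj₁ σ′ eq₃)) (proj₁ (embed-inj₁ τ′ eq₄))
    = refl , refl , label-injective (trans (sym A≡e′) A≡e)
  labelled-block-determined {p} p≢q (inj₁ _) (inj₂ _) σ′ τ′ A≡e A≡e′ _ eq₃ eq₄
    with refl , _ ← embed-inj₂ τ′ eq₄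
    with refl , refl ← A-L⁺-orthogonal p (trans A≡e′ (sym A≡e)) (proj₁ (embed-inj₁ σ′ eq₃))
    = refl , refl , refl
  labelled-block-determined {q = q} p≢q (inj₂ _) (inj₁ _) σ′ τ′ A≡e A≡e′ _ eq₃ eq₄
    with refl , _ ← embed-inj₂ σ′ eq₃
    with refl , refl ← A-L⁺-orthogonal q (trans A≡e′ (sym A≡e)) (proj₁ (embed-inj₁ τ′ eq₄))
    = refl , refl , refl
  labelled-block-determined p≢q (inj₂ _) (inj₂ _) _ _ _ _ ¬R _ _ = ⊥-elim (¬R refl)

  labelled-labelled : ∀ {p q} → p ≢ q → ∀ {x y e r c x′ y′ e′ r′ c′} →
                      Valid (labelled x y e r c) → Valid (labelled x′ y′ e′ r′ c′) →
                      Determines p q (labelled x y e r c) (labelled x′ y′ e′ r′ c′)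
  labelled-labelled {p} {q} p≢q {x} {y} {e} {r} {c} {x′} {y′} {e′} {r′} {c′} (A≡e , _) (A≡e′ , _)
                    ¬R e₁ e₂ e₃ e₄
    with σ  , Ip  , refl ← just-preimage (I⁺ p r c) e₁
       | τ  , Iq  , refl ← just-preimage (I⁺ q r c) e₂
       | σ′ , Ip′ , eq₃  ← just-preimage (I⁺ p r′ c′) e₃
       | τ′ , Iq′ , eq₄  ← just-preimage (I⁺ q r′ c′) e₄
    with refl , refl , refl ← labelled-block-determined p≢q σ τ σ′ τ′ A≡e A≡e′ ¬R eq₃ eq₄
    with refl ← embed-injective σ′ σ eq₃
       | refl ← embed-injective τ′ τ eq₄
    with refl , refl ← withAxes-no-repeats I p≢q (embed-not-both-in-hole σ τ ¬R) Ip Iq Ip′ Iq′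
    = refl

  labelled-plain : ∀ {p q} → p ≢ q → ∀ {x y e r c x′ y′ a b} →
                   Valid (labelled x y e r c) → Valid (plain x′ y′ a b) →
                   Determines p q (labelled x y e r c) (plain x′ y′ a b)
  labelled-plain {p} {q} p≢q {x} {y} {e} {r} {c} {x′} {y′} {a} {b} (A≡e , _) (_ , unlabelled) ¬R e₁ e₂ e₃ e₄
    with σ  , _ , refl ← just-preimage (I⁺ p r c) e₁
       | τ  , _ , refl ← just-preimage (I⁺ q r c) e₂
       | σ′ , _ , eq₃  ← just-preimage (M⁺ p a b) e₃
       | τ′ , _ , eq₄  ← just-preimage (M⁺ q a b) e₄
    with refl , refl ← L⁺-orthogonal p≢q (proj₁ (embed-inj₁ σ (sym eq₃))) (proj₁ (embed-inj₁ τ (sym eq₄)))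
    = ⊥-elim (labelled⇒not-unlabelled A≡e unlabelled)

  labelled-infinite : ∀ {p q x y e r c w w′} → Determines p q (labelled x y e r c) (infinite w w′)
  labelled-infinite {p} {q} {x} {y} {e} {r} {c} {w} {w′} ¬R e₁ e₂ e₃ e₄
    with σ , _ , refl ← just-preimage (I⁺ p r c) e₁
       | τ , _ , refl ← just-preimage (I⁺ q r c) e₂
       | _ , _ , eq₃  ← just-preimage (U⁺ p w w′) e₃
       | _ , _ , eq₄  ← just-preimage (U⁺ q w w′) e₄
    with refl , refl ← embed-inj₂ σ (sym eq₃)
       | refl , refl ← embed-inj₂ τ (sym eq₄)
    = ⊥-elim (¬R refl)

  entry-determines : ∀ {p q} → p ≢ q → ∀ s s′ → Valid s → Valid s′ → Determines p q s s′
  entry-determines p≢q (diagonal _ _ _)     (diagonal _ _ _)     _ _  = diagonal-diagonal p≢q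
  entry-determines p≢q (diagonal _ _ _)     (labelled _ _ _ _ _) _ v′ = diagonal-labelled p≢q v′
  entry-determines p≢q (diagonal _ _ _)     (plain _ _ _ _)      _ v′ = diagonal-plain p≢q v′
  entry-determines p≢q (labelled _ _ _ _ _) (labelled _ _ _ _ _) v v′ = labelled-labelled p≢q v v′
  entry-determines p≢q (labelled _ _ _ _ _) (plain _ _ _ _)      v v′ = labelled-plain p≢q v v′
  entry-determines p≢q (plain _ _ _ _)      (plain _ _ _ _)      _ _  = plain-plain p≢q
  entry-determines p≢q (infinite _ _)       (infinite _ _)       _ _  = infinite-infinite p≢q
  entry-determines {p} {q} _ (diagonal _ _ _)     (infinite _ _)       _ _ = diagonal-infinite {p} {q}
  entry-determines {p} {q} _ (labelled _ _ _ _ _) (infinite _ _)       _ _ = labelled-infinite {p} {q}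
  entry-determines {p} {q} _ (plain _ _ _ _)      (infinite _ _)       _ _ = plain-infinite {p} {q}
  entry-determines {p} {q} p≢q s@(labelled _ _ _ _ _) s′@(diagonal _ _ _) v _ =
    determines-sym {p} {q} s′ s (diagonal-labelled p≢q v)
  entry-determines {p} {q} p≢q s@(plain _ _ _ _) s′@(diagonal _ _ _) v _ =
    determines-sym {p} {q} s′ s (diagonal-plain p≢q v)
  entry-determines {p} {q} p≢q s@(plain _ _ _ _) s′@(labelled _ _ _ _ _) v v′ =
    determines-sym {p} {q} s′ s (labelled-plain p≢q v′ v)
  entry-determines {p} {q} _ s@(infinite _ _) s′@(diagonal _ _ _) _ _ =
    determines-sym {p} {q} s′ s (diagonal-infinite {p} {q})
  entry-determines {p} {q} _ s@(infinite _ _) s′@(labelled _ _ _ _ _) _ _ =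
    determines-sym {p} {q} s′ s (labelled-infinite {p} {q})
  entry-determines {p} {q} _ s@(infinite _ _) s′@(plain _ _ _ _) _ _ =
    determines-sym {p} {q} s′ s (plain-infinite {p} {q})

  module _ (p : Fin k) where
    private
      Gp : PartialLatin Q RQ
      Gp = MOPLS.square G p
      Mp : PartialLatin Q (λ _ _ → ⊥)
      Mp = MOPLS.square M p
      Ip : PartialLatin (Q ⊎ H) BothInHole
      Ip = MOPLS.square I p
      Up : PartialLatin (Fin u × H) SameHole
      Up = MOPLS.square U p

    entry-empty : ∀ s → Valid s → entry (inj₁ p) s ≡ nothing → RV (siteRow s) (siteColumn s)
    entry-empty (diagonal x a b)     _          eq = refl , emptyR Gp a b (nothing-preimage _ eq)
    entry-empty (labelled x y e r c) (_ , ¬both) eq = ⊥-elim (¬both (emptyR Ip r c (nothing-preimage _ eq)))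
    entry-empty (plain x y a b)      _          eq = ⊥-elim (emptyR Mp a b (nothing-preimage _ eq))
    entry-empty (infinite w w′)      _          eq = emptyR Up w w′ (nothing-preimage _ eq)

    entry-hole : ∀ s → Valid s → RV (siteRow s) (siteColumn s) → entry (inj₁ p) s ≡ nothing
    entry-hole (diagonal x a b) _ (_ , hole) = cong (map _) (Rempty Gp a b hole)
    entry-hole (labelled x y e (inj₁ _) (inj₁ _)) (A≡e , _) (x≡y , _) = ⊥-elim (labelled⇒off-diagonal A≡e x≡y)
    entry-hole (labelled x y e (inj₂ _) (inj₂ _)) (_ , ¬both) _ = ⊥-elim (¬both (tt , tt))
    entry-hole (plain x y a b) (x≢y , _) (x≡y , _) = ⊥-elim (x≢y x≡y)
    entry-hole (infinite w w′) _ hole = cong (map inj₂) (Rempty Up w w′ hole)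

    entry-avoids-row : ∀ s → Valid s → ∀ {α} → entry (inj₁ p) s ≡ just α → ¬ RV α (siteRow s)
    entry-avoids-row (diagonal x a b) _ eq with σ , G≡ , refl ← just-preimage (cell Gp a b) eq =
      avoidRow Gp a b σ G≡ ∘ proj₂
    entry-avoids-row (labelled x y e r c) (A≡e , _) eq with σ , I≡ , refl ← just-preimage (cell Ip r c) eq =
      embed-separated σ r (L-moves-row p (labelled⇒off-diagonal A≡e)) (avoidRow Ip r c σ I≡)
    entry-avoids-row (plain x y a b) (x≢y , _) eq with σ , _ , refl ← just-preimage (cell Mp a b) eq =
      L-moves-row p x≢y ∘ proj₁
    entry-avoids-row (infinite w w′) _ eq with σ , U≡ , refl ← just-preimage (cell Up w w′) eq =
      avoidRow Up w w′ σ U≡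

    entry-avoids-column : ∀ s → Valid s → ∀ {α} → entry (inj₁ p) s ≡ just α → ¬ RV α (siteColumn s)
    entry-avoids-column (diagonal x a b) _ eq with σ , G≡ , refl ← just-preimage (cell Gp a b) eq =
      avoidCol Gp a b σ G≡ ∘ proj₂
    entry-avoids-column (labelled x y e r c) (A≡e , _) eq with σ , I≡ , refl ← just-preimage (cell Ip r c) eq =
      embed-separated σ c (L-moves-column p (labelled⇒off-diagonal A≡e)) (avoidCol Ip r c σ I≡)
    entry-avoids-column (plain x y a b) (x≢y , _) eq with σ , _ , refl ← just-preimage (cell Mp a b) eq =
      L-moves-column p x≢y ∘ proj₁
    entry-avoids-column (infinite w w′) _ eq with σ , U≡ , refl ← just-preimage (cell Up w w′) eq =
      avoidCol Up w w′ σ U≡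

  entry-covers : ∀ {p q} → p ≢ q → ∀ α β → ¬ RV α β →
                 ∃ λ s → Valid s × entry (inj₁ p) s ≡ just α × entry (inj₁ q) s ≡ just β
  entry-covers {p} {q} p≢q (inj₁ (z , σ)) (inj₁ (w , τ)) ¬R with z Fin.≟ w
  ... | yes refl with a , b , Gp , Gq ← MOPLS.covers G p≢q σ τ (λ hole → ¬R (refl , hole)) =
    diagonal z a b , tt , cong (map _) Gp , cong (map _) Gq
  ... | no z≢w with x , y , refl , refl ← orthogonal⇒covers (L-orthogonal p≢q) z w
                  | unlabel (A x y) in unlabelled
  ...   | just e with r , c , Ip , Iq ← MOPLS.covers I p≢q (inj₁ σ) (inj₁ τ) (λ ()) =
    labelled x y e r c , (sym (unlabel-just unlabelled) , filled⇒not-hole (MOPLS.square I p) Ip) ,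
    cong (map _) Ip , cong (map _) Iq
  ...   | nothing with a , b , Mp , Mq ← MOPLS.covers M p≢q σ τ (λ ()) =
    plain x y a b , (x≢y , unlabelled) , cong (map _) Mp , cong (map _) Mq
    where
    x≢y : x ≢ y
    x≢y refl = z≢w (trans (L-idempotent p x) (sym (L-idempotent q x)))
  entry-covers {p} {q} p≢q (inj₁ (z , σ)) (inj₂ (e , j)) ¬R
    with x , y , A≡e , refl ← orthogonal⇒covers (A-L-orthogonal p) (label e) z
       | r , c , Ip , Iq ← MOPLS.covers I p≢q (inj₁ σ) (inj₂ j) (λ ()) =
    labelled x y e r c , (A≡e , filled⇒not-hole (MOPLS.square I p) Ip) , cong (map _) Ip , cong (map _) Iq
  entry-covers {p} {q} p≢q (inj₂ (e , j)) (inj₁ (w , τ)) ¬R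
    with x , y , A≡e , refl ← orthogonal⇒covers (A-L-orthogonal q) (label e) w
       | r , c , Ip , Iq ← MOPLS.covers I p≢q (inj₂ j) (inj₁ τ) (λ ()) =
    labelled x y e r c , (A≡e , filled⇒not-hole (MOPLS.square I p) Ip) , cong (map _) Ip , cong (map _) Iq
  entry-covers p≢q (inj₂ w₁) (inj₂ w₂) ¬R with w₃ , w₄ , Up , Uq ← MOPLS.covers U p≢q w₁ w₂ ¬R =
    infinite w₃ w₄ , tt , cong (map inj₂) Up , cong (map inj₂) Uq

  site-injective : ∀ {r c r′ c′} → site r c ≡ site r′ c′ → r ≡ r′ × c ≡ c′
  site-injective {r} {c} {r′} {c′} eq =
    trans (sym (site-row r c)) (trans (cong siteRow eq) (site-row r′ c′)) ,
    trans (sym (site-column r c)) (trans (cong siteColumn eq) (site-column r′ c′))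

  outArray : Index k → Array V
  outArray p r c = entry p (site r c)

  outArray-axis : ∀ a r c → outArray (inj₂ a) r c ≡ just (axisSquare a r c)
  outArray-axis a r c =
    trans (entry-axis a (site r c)) (cong₂ (λ r′ c′ → just (axisSquare a r′ c′)) (site-row r c) (site-column r c))

  out-determines : ∀ {p q} → p ≢ q → NoRepeatedPair RV (outArray p) (outArray q)
  out-determines p≢q {i = i} {j} {i′} {j′} ¬R e₁ e₂ e₃ e₄ =
    site-injective
      (entry-determines p≢q (site i j) (site i′ j′) (site-valid i j) (site-valid i′ j′) ¬R e₁ e₂ e₃ e₄)

  outSquare : Fin k → PartialLatin V RV
  outSquare p = record
    { cell     = outArray (inj₁ p)
    ; emptyR   = λ r c eq → subst₂ RV (site-row r c) (site-column r c) (entry-empty p (site r c) (site-valid r c) eq)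
    ; Rempty   = λ r c hole → entry-hole p (site r c) (site-valid r c)
                                (subst₂ RV (sym (site-row r c)) (sym (site-column r c)) hole)
    ; rowInj   = λ r c c′ s e₁ e₂ →
        proj₂ (out-determines {inj₁ p} {inj₂ byRow} (λ ()) {i = r} {c} {r} {c′} (avoidsRow r c e₁)
                              e₁ (outArray-axis byRow r c) e₂ (outArray-axis byRow r c′))
    ; colInj   = λ r r′ c s e₁ e₂ →
        proj₁ (out-determines {inj₁ p} {inj₂ byColumn} (λ ()) {i = r} {c} {r′} {c} (avoidsColumn r c e₁)
                              e₁ (outArray-axis byColumn r c) e₂ (outArray-axis byColumn r′ c))
    ; avoidRow = λ r c s → avoidsRow r c
    ; avoidCol = λ r c s → avoidsColumn r c
    }
    where
    avoidsRow : ∀ r c {s} → outArray (inj₁ p) r c ≡ just s → ¬ RV s r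
    avoidsRow r c {s} eq =
      subst (λ r′ → ¬ RV s r′) (site-row r c) (entry-avoids-row p (site r c) (site-valid r c) eq)
    avoidsColumn : ∀ r c {s} → outArray (inj₁ p) r c ≡ just s → ¬ RV s c
    avoidsColumn r c {s} eq =
      subst (λ c′ → ¬ RV s c′) (site-column r c) (entry-avoids-column p (site r c) (site-valid r c) eq)

  result : MOPLS V RV k
  result = record
    { square     = outSquare
    ; covers     = λ p≢q α β ¬R →
        let (s , valid , e₁ , e₂) = entry-covers p≢q α β ¬R
        in siteRow s , siteColumn s ,
           trans (cong (entry _) (site-of-valid s valid)) e₁ , trans (cong (entry _) (site-of-valid s valid)) e₂
    ; no-repeats = λ p≢q → out-determines (p≢q ∘ inj₁-injective)
    }

-- MOLS, HMOLS and IMOLS on Fin n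

fromPartialLS : ∀ {v R} → PartialLS v R → PartialLatin (Fin v) R
fromPartialLS L = record
  { cell = L.cell ; emptyR = L.emptyR ; Rempty = L.Rempty ; rowInj = L.rowInj ; colInj = L.colInj
  ; avoidRow = L.avoidRow ; avoidCol = L.avoidCol }
  where module L = PartialLS L

toPartialLS : ∀ {v R} → PartialLatin (Fin v) R → PartialLS v R
toPartialLS L = record
  { cell = cell L ; emptyR = emptyR L ; Rempty = Rempty L ; rowInj = rowInj L ; colInj = colInj L
  ; avoidRow = avoidRow L ; avoidCol = avoidCol L }

fromMutuallyOrthogonal : ∀ {v R k} → MutuallyOrthogonal v R k → MOPLS (Fin v) R k
fromMutuallyOrthogonal (Ls , orth) = record
  { square     = fromPartialLS ∘ Ls
  ; covers     = λ p≢q a b ¬Rab → let (i , j , cells , _) = orth _ _ p≢q a b ¬Rab in i , j , cells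
  ; no-repeats = λ p≢q ¬Rab e₁ e₂ e₃ e₄ →
      let (_ , _ , _ , unique) = orth _ _ p≢q _ _ ¬Rab
          (i≡ , j≡) = unique _ _ e₁ e₂
          (i′≡ , j′≡) = unique _ _ e₃ e₄
      in trans i≡ (sym i′≡) , trans j≡ (sym j′≡)
  }

toMutuallyOrthogonal : ∀ {v R k} → MOPLS (Fin v) R k → MutuallyOrthogonal v R k
toMutuallyOrthogonal 𝓛 = toPartialLS ∘ square , λ p q p≢q a b ¬Rab →
  let (i , j , Fij , Gij) = covers p≢q a b ¬Rab
  in i , j , (Fij , Gij) , λ i′ j′ e₁ e₂ → no-repeats p≢q ¬Rab e₁ e₂ Fij Gij
  where open MOPLS 𝓛

module _ {t k : ℕ} (𝓛 : MOPLS (Fin t) NoHole k) where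
  open MOPLS 𝓛

  private
    filled : ∀ p x y → ∃ λ s → cell (square p) x y ≡ just s
    filled p x y with cell (square p) x y | emptyR (square p) x y
    ... | just s  | _     = s , refl
    ... | nothing | empty = ⊥-elim (empty refl)

    value : Fin k → Square (Fin t)
    value p x y = proj₁ (filled p x y)

    value-cell : ∀ p {x y s} → value p x y ≡ s → cell (square p) x y ≡ just s
    value-cell p {x} {y} refl = proj₂ (filled p x y)

  completeSquares : MOLS t k
  completeSquares = record
    { square     = value
    ; latin      = λ p → record
      { row-injective    = λ x eq → rowInj (square p) x _ _ _ (value-cell p refl) (value-cell p (sym eq))
      ; column-injective = λ y eq → colInj (square p) _ _ y _ (value-cell p refl) (value-cell p (sym eq)) }
    ; orthogonal = λ p≢q eq eq′ →
        no-repeats p≢q (λ ()) (value-cell _ refl) (value-cell _ refl) (value-cell _ (sym eq)) (value-cell _ (sym eq′))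
    }

fromHasHMOLS : ∀ {h n k} → HasHMOLS h n k → MOPLS (Fin n × Fin h) SameHole k
fromHasHMOLS (hole , fibre , 𝓛) = toHoleCoordinates hole fibre (fromMutuallyOrthogonal 𝓛)

toHasHMOLS : ∀ {Y : Set} {h n k} → Y ↔ Fin n → MOPLS (Y × Fin h) SameHole k → HasHMOLS h n k
toHasHMOLS {Y} {h} {n} e 𝓛 = proj₁ ∘ from φ , proj₁-fibre φ ,
  toMutuallyOrthogonal (Transport.transport φ (λ _ _ eq → eq) (λ _ _ eq → eq)
    (Transport.transport (×-cong e ↔-refl) (λ _ _ → cong (from e)) (λ _ _ → ↔-injective (↔-sym e)) 𝓛))
  where
  φ : (Fin n × Fin h) ↔ Fin (h * n)
  φ = ↔-trans (×-comm (Fin n) (Fin h)) (↔-sym Fin.*↔×)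

fromHasMOLS : ∀ {A : Set} {v k} → A ↔ Fin v → HasMOLS v k → MOPLS A (λ _ _ → ⊥) k
fromHasMOLS φ 𝓛 = Transport.transport (↔-sym φ) (λ _ _ ()) (λ _ _ ()) (fromMutuallyOrthogonal 𝓛)

fromHasIMOLS : ∀ {A : Set} {g h k} → A ↔ Fin g → HasIMOLS (g + h) h k → MOPLS (A ⊎ Fin h) BothInHole k
fromHasIMOLS {A} {g} {h} φ (H , ∣H∣≡h , 𝓛) = Transport.transport e S⇒R R⇒S (fromMutuallyOrthogonal 𝓛)
  where
  ∣∁H∣≡g : ∣ ∁ H ∣ ≡ g
  ∣∁H∣≡g = trans (∣∁p∣≡n∸∣p∣ H) (trans (cong (g + h ∸_) ∣H∣≡h) (ℕ.m+n∸n≡m g h))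
  e : Fin (g + h) ↔ (A ⊎ Fin h)
  e = ↔-trans (↔-sym (subset-partition H)) (⊎-cong (↔-trans (cast-id ∣∁H∣≡g) (↔-sym φ)) (cast-id ∣H∣≡h))
  in-hole⇒∈ : ∀ x → InHole x → from e x ∈ H
  in-hole⇒∈ (inj₂ j) _ = enumerate-∈ H _
  ∈⇒in-hole : ∀ x → from e x ∈ H → InHole x
  ∈⇒in-hole (inj₁ i) i∈H = enumerate-∉ H _ i∈H
  ∈⇒in-hole (inj₂ j) _   = _
  S⇒R : ∀ a c → BothInHole a c → from e a ∈ H × from e c ∈ H
  S⇒R a c (a-in , c-in) = in-hole⇒∈ a a-in , in-hole⇒∈ c c-in
  R⇒S : ∀ a c → from e a ∈ H × from e c ∈ H → BothInHole a c
  R⇒S a c (a∈H , c∈H) = ∈⇒in-hole a a∈H , ∈⇒in-hole c c∈H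

module _ {t u : ℕ} (u<t : u < t) where
  private
    label : Fin u → Fin t
    label e = inject≤ e (ℕ.<⇒≤ u<t)

    toℕ-label : ∀ e → toℕ (label e) ≡ toℕ e
    toℕ-label e = Fin.toℕ-inject≤ e (ℕ.<⇒≤ u<t)

    unlabel : Fin t → Maybe (Fin u)
    unlabel c with toℕ c ℕ.<? u
    ... | yes c<u = just (fromℕ< c<u)
    ... | no _    = nothing

    unlabel-label : ∀ e → unlabel (label e) ≡ just e
    unlabel-label e with toℕ (label e) ℕ.<? u
    ... | yes c<u = cong just (Fin.toℕ-injective (trans (Fin.toℕ-fromℕ< c<u) (toℕ-label e)))
    ... | no c≮u  = ⊥-elim (c≮u (subst (_< u) (sym (toℕ-label e)) (Fin.toℕ<n e)))

    unlabel-just : ∀ {c e} → unlabel c ≡ just e → label e ≡ c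
    unlabel-just {c} eq with toℕ c ℕ.<? u
    unlabel-just {c} refl | yes c<u = Fin.toℕ-injective (trans (toℕ-label _) (Fin.toℕ-fromℕ< c<u))

    label≢d : ∀ e → label e ≢ fromℕ< u<t
    label≢d e eq = ℕ.<⇒≢ (Fin.toℕ<n e) (trans (sym (toℕ-label e)) (trans (cong toℕ eq) (Fin.toℕ-fromℕ< u<t)))

  labelling : Labelling t u (fromℕ< u<t)
  labelling = record
    { label = label ; label≢d = label≢d ; unlabel = unlabel
    ; unlabel-label = unlabel-label ; unlabel-just = unlabel-just }

proposition3p3 : ∀ (h m t u k : ℕ) → 1 ≤ h → 1 ≤ m → 1 ≤ t → u < t →
    HasMOLS t (suc k) → HasHMOLS h m k → HasMOLS (h * m) k →
    HasIMOLS (h * m + h) h k → HasHMOLS h u k →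
    HasHMOLS h (m * t + u) k
proposition3p3 h m t u k _ _ _ u<t 𝓐 𝓖 𝓜 𝓘 𝓤 = toHasHMOLS blocks (regroup-holes result)
  where
  grid : (Fin m × Fin h) ↔ Fin (h * m)
  grid = ↔-trans (×-comm (Fin m) (Fin h)) (↔-sym Fin.*↔×)

  blocks : ((Fin t × Fin m) ⊎ Fin u) ↔ Fin (m * t + u)
  blocks = ↔-trans (⊎-cong (↔-sym Fin.*↔×) ↔-refl)
                   (↔-trans (↔-sym Fin.+↔⊎) (cast-id (cong (_+ u) (ℕ.*-comm t m))))

  open Construction (labelling u<t) (normalise (completeSquares (fromMutuallyOrthogonal 𝓐)) (fromℕ< u<t))
                    (fromHasHMOLS 𝓖) (fromHasMOLS grid 𝓜) (fromHasIMOLS grid 𝓘) (fromHasHMOLS 𝓤)
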